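{- Let $k\geq 1$ be an integer and let $G$ be a tournament that contains no induced subdigraph isomorphic to $\Delta(1,1,k)$. Then every vertex of $G$ has triangle degree less than $2^{2k-2}$.
   Context: A tournament is an orientation of a complete graph (for every two distinct vertices exactly one of the two arcs between them is present). $TT_k$ denotes the transitive (acyclic) tournament on $k$ vertices. $\Delta(1,1,k)$ is the tournament with vertices $x,y$ and a copy $T$ of $TT_k$, with arcs $x\to y$, $y\to t$ and $t\to x$ for all $t\in V(T)$ (plus the arcs inside $T$). A directed triangle is a directed cycle on three vertices. The triangle degree of a vertex $x$ in a digraph $G$ is the maximum size of a collection of directed triangles of $G$ that pairwise share the vertex $x$ but no other vertex. -}

module Defs where

open import Data.Nat using (ℕ; zero; suc; _+_; _^_; _*_; _∸_; _<_)
open import Data.Fin using (Fin; zero; suc) renaming (_<_ to _<ᶠ_)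
open import Data.Product using (Σ; _×_; _,_; proj₁; proj₂)
open import Data.Sum using (_⊎_)
open import Relation.Nullary using (¬_)
open import Relation.Binary.PropositionalEquality using (_≡_; _≢_)
open import Function.Bundles using (_⇔_)
open import Data.Unit using (⊤)
open import Data.Empty using (⊥)

record Tournament (n : ℕ) : Set₁ where
  field
    _⇒_     : Fin n → Fin n → Set
    irrefl  : ∀ x → ¬ (x ⇒ x)
    asym    : ∀ {x y} → x ⇒ y → ¬ (y ⇒ x)
    total   : ∀ x y → x ≢ y → (x ⇒ y) ⊎ (y ⇒ x)

-- Arc relation of Δ(1,1,k) on Fin (2 + k):
--   zero = x, suc zero = y, suc (suc i) = t_i (the copy of TT_k, t_i → t_j iff i < j).
ΔArc : (k : ℕ) → Fin (2 + k) → Fin (2 + k) → Set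
ΔArc k zero           (suc zero)      = ⊤
ΔArc k (suc zero)     (suc (suc j))   = ⊤
ΔArc k (suc (suc i))  zero            = ⊤
ΔArc k (suc (suc i))  (suc (suc j))   = i <ᶠ j
ΔArc k _              _               = ⊥

ContainsInducedΔ : ∀ {n} → Tournament n → ℕ → Set
ContainsInducedΔ {n} G k =
  Σ (Fin (2 + k) → Fin n) λ f →
    (∀ i j → f i ≡ f j → i ≡ j) ×
    (∀ i j → (Tournament._⇒_ G (f i) (f j)) ⇔ ΔArc k i j)

-- A collection of m such triangles pairwise sharing only x:
-- all 2m vertices a_i, b_i are pairwise distinct (note a_i, b_i ≢ x automatically).
TriangleCollection : ∀ {n} → Tournament n → Fin n → ℕ → Set
TriangleCollection {n} G x m =
  Σ (Fin m → Fin n) λ a → Σ (Fin m → Fin n) λ b →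
    (∀ i → (x ⇒ a i) × (a i ⇒ b i) × (b i ⇒ x)) ×
    (∀ i j → a i ≡ a j → i ≡ j) ×
    (∀ i j → b i ≡ b j → i ≡ j) ×
    (∀ i j → a i ≢ b j)
  where open Tournament G

TriangleDegree< : ∀ {n} → Tournament n → Fin n → ℕ → Set
TriangleDegree< G x N = ∀ m → TriangleCollection G x m → m < N

-- Let x → aᵢ → bᵢ → x (i < m) be triangles meeting only in x, with m ≥ 2^(2k-2).
-- Every tournament on 2^r vertices has a transitive subtournament on r + 1 vertices,
-- so some 2k - 1 of the bᵢ form a transitive chain; let b be its source and a its
-- partner, and let T be the remaining 2k - 2 chain vertices, so b → T → x.  Half of T,
-- at least k - 1 vertices, lies on one side of a.  If a → T' then x, a and the chain
-- b, T' induce Δ(1,1,k); if T' → a then a, b and the chain T', x do.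
module Submission where

open import Defs
open import Data.Nat using (ℕ; _≤_; _^_; _*_; _∸_)
open import Data.Fin using (Fin)
open import Relation.Nullary using (¬_)

open import Data.Nat using (zero; suc; _+_; _<_; s≤s; _≤?_)
open import Data.Nat.Properties
  using (≤-reflexive; ≤-trans; n≤1+n; <⇒≱; ≰⇒>; +-suc; +-comm; +-identityʳ; +-mono-≤; *-suc; m+n∸m≡n; m^n>0; suc-injective; module ≤-Reasoning)
open import Data.Fin using (zero; suc; inject≤)
import Data.Fin as Fin
open import Data.Fin.Properties using (<-cmp; toℕ-inject≤)
open import Data.List using (List; []; _∷_; _++_; [_]; length; map; lookup; allFin)
open import Data.List.Properties using (length-map; length-++; length-tabulate)
open import Data.List.Membership.Propositional using (_∈_)
open import Data.List.Membership.Propositional.Properties using (∈-lookup)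
open import Data.List.Relation.Unary.Any using (here; there)
open import Data.List.Relation.Unary.All as All using (All; []; _∷_)
import Data.List.Relation.Unary.All.Properties as All
open import Data.List.Relation.Unary.AllPairs using (AllPairs; []; _∷_)
import Data.List.Relation.Unary.AllPairs.Properties as AllPairs
open import Data.List.Relation.Unary.Unique.Propositional using (Unique)
open import Data.List.Relation.Unary.Unique.Propositional.Properties using (allFin⁺)
open import Data.List.Relation.Binary.Sublist.Propositional using (_⊆_; _⊇_; []; _∷_; _∷ʳ_)
open import Data.List.Relation.Binary.Sublist.Propositional.Properties using (All-resp-⊆; Any-resp-⊆)
open import Data.Product using (∃-syntax; ∃₂; _×_; _,_; proj₁; proj₂)
open import Data.Sum using (_⊎_; inj₁; inj₂)
open import Data.Empty using (⊥-elim)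
open import Relation.Nullary using (yes; no; contradiction)
open import Level using (0ℓ)
open import Relation.Binary using (Rel; _Respects_; tri<; tri≈; tri>)
open import Relation.Binary.PropositionalEquality using (_≡_; _≢_; refl; sym; trans; cong; subst; subst₂)
open import Function.Bundles using (mk⇔)

pigeonhole : ∀ c p q → 2 * c ≤ suc (p + q) → c ≤ p ⊎ c ≤ q
pigeonhole c p q 2c≤ with c ≤? p | c ≤? q
... | yes c≤p | _       = inj₁ c≤p
... | no _    | yes c≤q = inj₂ c≤q
... | no c≰p  | no c≰q  = contradiction 2c≤ (<⇒≱ (begin-strict
    suc (p + q)      <⟨ s≤s (≤-reflexive (sym (+-suc p q))) ⟩
    suc p + suc q    ≤⟨ +-mono-≤ (≰⇒> c≰p) (≰⇒> c≰q) ⟩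
    c + c            ≡⟨ cong (c +_) (sym (+-identityʳ c)) ⟩
    2 * c            ∎))
  where open ≤-Reasoning

2*suc∸2 : ∀ k → 2 * suc k ∸ 2 ≡ 2 * k
2*suc∸2 k = trans (cong (_∸ 2) (*-suc 2 k)) (m+n∸m≡n 2 (2 * k))

module _ {A : Set} where

  AllPairs-resp-⊇ : {R : Rel A 0ℓ} → AllPairs R Respects _⊇_
  AllPairs-resp-⊇ []         []       = []
  AllPairs-resp-⊇ (_ ∷ʳ ys)  (_ ∷ rs) = AllPairs-resp-⊇ ys rs
  AllPairs-resp-⊇ (refl ∷ ys) (r ∷ rs) = All-resp-⊆ ys r ∷ AllPairs-resp-⊇ ys rs

  AllPairs-lookup : {R : Rel A 0ℓ} {xs : List A} → AllPairs R xs →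
    ∀ {i j} → i Fin.< j → R (lookup xs i) (lookup xs j)
  AllPairs-lookup (r ∷ _)  {zero}  {suc j} _         = All.lookup r (∈-lookup j)
  AllPairs-lookup (_ ∷ rs) {suc i} {suc j} (s≤s i<j) = AllPairs-lookup rs i<j

  partition-⊎ : {P Q : A → Set} (xs : List A) → All (λ x → P x ⊎ Q x) xs →
    ∃₂ λ ps qs → ps ⊆ xs × qs ⊆ xs × All P ps × All Q qs × length ps + length qs ≡ length xs
  partition-⊎ [] [] = [] , [] , [] , [] , [] , [] , refl
  partition-⊎ (x ∷ xs) (px⊎qx ∷ rest) with partition-⊎ xs rest | px⊎qx
  ... | ps , qs , ps⊆ , qs⊆ , Pps , Qqs , len | inj₁ px =
    x ∷ ps , qs , refl ∷ ps⊆ , x ∷ʳ qs⊆ , px ∷ Pps , Qqs , cong suc len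
  ... | ps , qs , ps⊆ , qs⊆ , Pps , Qqs , len | inj₂ qx =
    ps , x ∷ qs , x ∷ʳ ps⊆ , refl ∷ qs⊆ , Pps , qx ∷ Qqs , trans (+-suc _ _) (cong suc len)

  module _ (R : Rel A 0ℓ) (total : ∀ {x y} → x ≢ y → R x y ⊎ R y x) where

    transitiveChain : ∀ r (xs : List A) → Unique xs → 2 ^ r ≤ length xs →
      ∃[ ts ] AllPairs R ts × All (_∈ xs) ts × length ts ≡ suc r
    transitiveChain r [] _ 2^r≤0 = contradiction 2^r≤0 (<⇒≱ (m^n>0 2 r))
    transitiveChain zero (v ∷ _) _ _ = v ∷ [] , [] ∷ [] , here refl ∷ [] , refl
    transitiveChain (suc r) (v ∷ xs) (v∉xs ∷ unique) size
      with partition-⊎ xs (All.map total v∉xs)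
    ... | outs , ins , outs⊆ , ins⊆ , v→outs , ins→v , len
      with pigeonhole (2 ^ r) (length outs) (length ins) (subst (λ l → 2 ^ suc r ≤ suc l) (sym len) size)
    ... | inj₁ large with transitiveChain r outs (AllPairs-resp-⊇ outs⊆ unique) large
    ...   | ts , chain , ts∈ , |ts| =
      v ∷ ts , All.map (All.lookup v→outs) ts∈ ∷ chain ,
      here refl ∷ All.map (λ t∈ → there (Any-resp-⊆ outs⊆ t∈)) ts∈ , cong suc |ts|
    transitiveChain (suc r) (v ∷ xs) (v∉xs ∷ unique) size
        | outs , ins , outs⊆ , ins⊆ , v→outs , ins→v , len | inj₂ large
      with transitiveChain r ins (AllPairs-resp-⊇ ins⊆ unique) large
    ...   | ts , chain , ts∈ , |ts| =
      ts ++ [ v ] , AllPairs.++⁺ chain ([] ∷ []) (All.map (λ t∈ → All.lookup ins→v t∈ ∷ []) ts∈) ,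
      All.∷ʳ⁺ (All.map (λ t∈ → there (Any-resp-⊆ ins⊆ t∈)) ts∈) (here refl) ,
      trans (length-++ ts) (trans (+-comm _ 1) (cong suc |ts|))

module _ {n} (G : Tournament n) where
  open Tournament G

  ⇒-≢ : ∀ {u v} → u ⇒ v → u ≢ v
  ⇒-≢ {v = v} u⇒v refl = irrefl v u⇒v

  module _ {k} (t : Fin k → Fin n) (chain : ∀ {i j} → i Fin.< j → t i ⇒ t j) where

    chain-injective : ∀ i j → t i ≡ t j → i ≡ j
    chain-injective i j ti≡tj with <-cmp i j
    ... | tri< i<j _ _ = ⊥-elim (⇒-≢ (chain i<j) ti≡tj)
    ... | tri≈ _ i≡j _ = i≡j
    ... | tri> _ _ j<i = ⊥-elim (⇒-≢ (chain j<i) (sym ti≡tj))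

    Δ-fromChain : ∀ {X Y} → X ⇒ Y → (∀ i → Y ⇒ t i) → (∀ i → t i ⇒ X) → ContainsInducedΔ G k
    Δ-fromChain {X} {Y} X⇒Y Y⇒t t⇒X = f , injective , λ i j → mk⇔ (reflects i j) (preserves i j)
      where
      f : Fin (2 + k) → Fin n
      f zero          = X
      f (suc zero)    = Y
      f (suc (suc i)) = t i

      injective : ∀ i j → f i ≡ f j → i ≡ j
      injective zero          zero          _ = refl
      injective zero          (suc zero)    e = ⊥-elim (⇒-≢ X⇒Y e)
      injective zero          (suc (suc j)) e = ⊥-elim (⇒-≢ (t⇒X j) (sym e))
      injective (suc zero)    zero          e = ⊥-elim (⇒-≢ X⇒Y (sym e))
      injective (suc zero)    (suc zero)    _ = refl
      injective (suc zero)    (suc (suc j)) e = ⊥-elim (⇒-≢ (Y⇒t j) e)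
      injective (suc (suc i)) zero          e = ⊥-elim (⇒-≢ (t⇒X i) e)
      injective (suc (suc i)) (suc zero)    e = ⊥-elim (⇒-≢ (Y⇒t i) (sym e))
      injective (suc (suc i)) (suc (suc j)) e = cong (λ l → suc (suc l)) (chain-injective i j e)

      preserves : ∀ i j → ΔArc k i j → f i ⇒ f j
      preserves zero          (suc zero)    _   = X⇒Y
      preserves (suc zero)    (suc (suc j)) _   = Y⇒t j
      preserves (suc (suc i)) zero          _   = t⇒X i
      preserves (suc (suc i)) (suc (suc j)) i<j = chain i<j

      reflects : ∀ i j → f i ⇒ f j → ΔArc k i j
      reflects zero          zero          h = irrefl X h
      reflects zero          (suc zero)    _ = _
      reflects zero          (suc (suc j)) h = asym h (t⇒X j)
      reflects (suc zero)    zero          h = asym h X⇒Y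
      reflects (suc zero)    (suc zero)    h = irrefl Y h
      reflects (suc zero)    (suc (suc j)) _ = _
      reflects (suc (suc i)) zero          _ = _
      reflects (suc (suc i)) (suc zero)    h = asym h (Y⇒t i)
      reflects (suc (suc i)) (suc (suc j)) h with <-cmp i j
      ... | tri< i<j _ _    = i<j
      ... | tri≈ _ refl _   = ⊥-elim (irrefl (t i) h)
      ... | tri> _ _ j<i    = ⊥-elim (asym h (chain j<i))

  Δ-fromList : ∀ {k X Y ts} → X ⇒ Y → All (Y ⇒_) ts → All (_⇒ X) ts → AllPairs _⇒_ ts →
    k ≤ length ts → ContainsInducedΔ G k
  Δ-fromList {k} {ts = ts} X⇒Y Y⇒ts ts⇒X chain k≤ =
    Δ-fromChain t (λ {i} {j} i<j → AllPairs-lookup chain (inject≤-mono i j i<j))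
      X⇒Y (λ i → All.lookup Y⇒ts (∈-lookup _)) (λ i → All.lookup ts⇒X (∈-lookup _))
    where
    t : Fin k → Fin n
    t i = lookup ts (inject≤ i k≤)
    inject≤-mono : ∀ i j → i Fin.< j → inject≤ i k≤ Fin.< inject≤ j k≤
    inject≤-mono i j = subst₂ _<_ (sym (toℕ-inject≤ i k≤)) (sym (toℕ-inject≤ j k≤))

  Δ-fromTriangleAndChain : ∀ {k x a b} ts → x ⇒ a → a ⇒ b → b ⇒ x →
    All (a ≢_) ts → All (b ⇒_) ts → All (_⇒ x) ts → AllPairs _⇒_ ts → 2 * k ≤ length ts →
    ContainsInducedΔ G (suc k)
  Δ-fromTriangleAndChain {k} {x} {a} {b} ts x⇒a a⇒b b⇒x a≢ts b⇒ts ts⇒x chain 2k≤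
    with partition-⊎ ts (All.map (total a _) a≢ts)
  ... | outs , ins , outs⊆ , ins⊆ , a⇒outs , ins⇒a , len
    with pigeonhole k (length outs) (length ins) (≤-trans 2k≤ (≤-trans (≤-reflexive (sym len)) (n≤1+n _)))
  ... | inj₁ large =
    Δ-fromList {ts = b ∷ outs} x⇒a (a⇒b ∷ a⇒outs) (b⇒x ∷ All-resp-⊆ outs⊆ ts⇒x)
      (All-resp-⊆ outs⊆ b⇒ts ∷ AllPairs-resp-⊇ outs⊆ chain) (s≤s large)
  ... | inj₂ large =
    Δ-fromList {ts = ins ++ [ x ]} a⇒b (All.∷ʳ⁺ (All-resp-⊆ ins⊆ b⇒ts) b⇒x) (All.∷ʳ⁺ ins⇒a x⇒a)
      (AllPairs.++⁺ (AllPairs-resp-⊇ ins⊆ chain) ([] ∷ []) (All.map (_∷ []) (All-resp-⊆ ins⊆ ts⇒x)))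
      (subst (suc k ≤_) (trans (+-comm 1 _) (sym (length-++ ins))) (s≤s large))

  largeTriangleCollection⇒Δ : ∀ {x m} k → TriangleCollection G x m → 2 ^ (2 * k) ≤ m →
    ContainsInducedΔ G (suc k)
  largeTriangleCollection⇒Δ {x} {m} k (a , b , triangle , _ , b-injective , a≢b) large
    with transitiveChain (λ i j → b i ⇒ b j)
           (λ {i} {j} i≢j → total (b i) (b j) (λ bi≡bj → i≢j (b-injective i j bi≡bj)))
           (2 * k) (allFin m) (allFin⁺ m) (subst (2 ^ (2 * k) ≤_) (sym (length-tabulate _)) large)
  ... | j ∷ ts , bj⇒bts ∷ chain , _ , |ts| =
    Δ-fromTriangleAndChain (map b ts) x⇒a a⇒b b⇒x
      (All.map⁺ (All.universal (a≢b j) ts)) (All.map⁺ bj⇒bts)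
      (All.map⁺ (All.universal (λ i → proj₂ (proj₂ (triangle i))) ts)) (AllPairs.map⁺ chain)
      (≤-reflexive (sym (trans (length-map b ts) (suc-injective |ts|))))
    where
    x⇒a : x ⇒ a j
    x⇒a = proj₁ (triangle j)
    a⇒b : a j ⇒ b j
    a⇒b = proj₁ (proj₂ (triangle j))
    b⇒x : b j ⇒ x
    b⇒x = proj₂ (proj₂ (triangle j))

lemma2p4 : (k : ℕ) → 1 ≤ k → (n : ℕ) → (G : Tournament n) →
    ¬ ContainsInducedΔ G k →
    (x : Fin n) → TriangleDegree< G x (2 ^ (2 * k ∸ 2))
lemma2p4 (suc k) _ n G no-Δ x m collection = ≰⇒> λ large →
  no-Δ (largeTriangleCollection⇒Δ G k collection (subst (λ e → 2 ^ e ≤ m) (2*suc∸2 k) large))
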